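{- Let $S = \{x_1 < x_2 < \cdots < x_p\}$ be an admissible pinnacle set. Then every ordering of $S$ is admissible if and only if for each $i$ with $1 < i < p$ one has $x_i \geq \min\{p+i+1, 3i\}$.
   Context: A permutation $w = w(1)\cdots w(n)$ of $[n]$ has a pinnacle $w(i)$ whenever $i\in[2,n-1]$ and $w(i-1) < w(i) > w(i+1)$. A set $S$ of positive integers is an admissible pinnacle set if some permutation has pinnacle set exactly $S$. An ordering of the elements of $S$ is admissible if there exists a permutation with pinnacle set $S$ whose pinnacles appear, left to right, in that order. -}

module Defs where

open import Data.Nat using (ℕ; zero; suc; _+_; _*_; _<_; _≤_; _⊓_; _<ᵇ_)
open import Data.Bool using (Bool; true; false; _∧_; if_then_else_)
open import Data.List using (List; []; _∷_; map)
open import Data.List.Relation.Binary.Permutation.Propositional using (_↭_)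
open import Data.Vec using (Vec; lookup; toList)
open import Data.Fin using (Fin; toℕ)
open import Data.Product using (Σ; ∃; _×_)
open import Relation.Binary.PropositionalEquality using (_≡_)

range1 : ℕ → List ℕ
range1 zero = []
range1 (suc n) = range1 n Data.List.++ (suc n ∷ [])

-- w (a list of naturals) is a permutation of [n] written in one-line notation
IsPermOf : ℕ → List ℕ → Set
IsPermOf n w = w ↭ range1 n

pinnacles : List ℕ → List ℕ
pinnacles (a ∷ b ∷ c ∷ rest) =
  if (a <ᵇ b) ∧ (c <ᵇ b)
    then b ∷ pinnacles (b ∷ c ∷ rest)
    else pinnacles (b ∷ c ∷ rest)
pinnacles _ = []

-- w has pinnacle set exactly the set of entries of the list S
-- (S has distinct entries; the pinnacle list of a permutation has distinct entries)
HasPinnacleSet : List ℕ → List ℕ → Set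
HasPinnacleSet w S = pinnacles w ↭ S

AdmissiblePinnacleSet : List ℕ → Set
AdmissiblePinnacleSet S = ∃ λ n → Σ (List ℕ) λ w → IsPermOf n w × HasPinnacleSet w S

AdmissibleOrdering : List ℕ → List ℕ → Set
AdmissibleOrdering S o =
  ∃ λ n → Σ (List ℕ) λ w → IsPermOf n w × HasPinnacleSet w S × pinnacles w ≡ o

-- a vector x_1, …, x_p (stored 0-indexed) is strictly increasing
StrictlyIncreasing : ∀ {p} → Vec ℕ p → Set
StrictlyIncreasing {p} x = ∀ (i j : Fin p) → toℕ i < toℕ j → lookup x i < lookup x j

PinnacleOrderCondition : ∀ {p} → Vec ℕ p → Set
PinnacleOrderCondition {p} x =
  ∀ (k : Fin p) → let i = suc (toℕ k) in
    1 < i → i < p → (p + i + 1) ⊓ (3 * i) ≤ lookup x k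

-- Call o₁, o₁ ⊓ o₂, …, oₖ₋₁ ⊓ oₖ, oₖ the valley bounds of a pinnacle order o₁ … oₖ: a permutation
-- with these pinnacles has k + 1 distinct non-pinnacle entries (the least entry before o₁, between
-- consecutive pinnacles, after oₖ), each below the corresponding bound.  Counting the entries below X
-- of a permutation of [n] gives  #{pinnacles < X} + #{bounds ≤ X} ≤ X − 1.
-- Necessity: for the order x₁, x_{i+1}, x₂, x_{i+2}, … and X = x_i this reads
-- (i − 1) + min(2i, p + 1) ≤ x_i − 1.  Sufficiency: this inequality for every i (for i = 1 and i = p it
-- follows from admissibility of S) is Hall's condition for choosing distinct valleys outside S below
-- the bounds of any order; a greedy choice succeeds, and the unused values are placed decreasingly in
-- front of the alternating word valley, pinnacle, valley, …, pinnacle, valley.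

module Submission where

open import Defs
open import Data.Bool using (Bool; true; false)
open import Data.Bool.Properties using (T-≡; ∧-zeroʳ)
open import Data.Fin using (Fin; toℕ) renaming (zero to fzero; suc to fsuc)
open import Data.Fin.Properties using (toℕ-injective; toℕ<n)
open import Data.List using (List; []; _∷_; _++_; length; take; drop; filter; applyDownFrom)
open import Data.List.Properties using (length-applyDownFrom; ++-identityʳ; take++drop≡id; length-++)
open import Data.List.Membership.Propositional using (_∈_; _∉_)
open import Data.List.Membership.Propositional.Properties
  using (∈-applyDownFrom⁺; ∈-applyDownFrom⁻; ∈-filter⁺; ∈-filter⁻; ∈-++⁺ˡ; ∈-++⁺ʳ; ∈-++⁻)
open import Data.List.Membership.Propositional.Properties.WithK using (unique∧set⇒bag)
open import Data.List.Relation.Binary.BagAndSetEquality using (∼bag⇒↭)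
open import Data.List.Relation.Binary.Permutation.Propositional
  using (_↭_; ↭-reflexive; ↭-refl; ↭-sym; ↭-trans; ↭-prep)
import Data.List.Relation.Binary.Permutation.Propositional as ↭
import Data.List.Relation.Binary.Permutation.Propositional.Properties as ↭
open import Data.List.Relation.Binary.Pointwise using (Pointwise; []; _∷_; Pointwise-length)
open import Data.List.Relation.Unary.All using (All; []; _∷_)
import Data.List.Relation.Unary.All as All
import Data.List.Relation.Unary.All.Properties as All
open import Data.List.Relation.Unary.AllPairs using (AllPairs; []; _∷_)
import Data.List.Relation.Unary.AllPairs as AllPairs
import Data.List.Relation.Unary.AllPairs.Properties as AllPairs
open import Data.List.Relation.Unary.Any using (here; there)
open import Data.List.Relation.Unary.Unique.Propositional using (Unique)
import Data.List.Relation.Unary.Unique.Propositional.Properties as Unique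
open import Data.Nat
open import Data.Nat.ListAction using (sum)
open import Data.Nat.Properties
open import Data.Nat.Tactic.RingSolver using (solve-∀)
open import Data.Product using (Σ; ∃; _×_; _,_; proj₁; proj₂; uncurry)
open import Data.Sum using (_⊎_; inj₁; inj₂)
open import Data.Unit using (⊤; tt)
open import Data.Vec using (Vec; toList; lookup; _∷_; [])
open import Data.Vec.Properties using (length-toList)
open import Function using (_∘_)
open import Function.Bundles using (_⇔_; mk⇔; Equivalence)
open import Relation.Binary.PropositionalEquality
open import Relation.Nullary using (yes; no; does; contradiction)
open import Data.List.Membership.DecPropositional _≟_ using (_∈?_; _∉?_)
import Data.List.Relation.Binary.Permutation.Setoid.Properties (setoid ℕ) as ↭ₛ using (Unique-resp-↭)

private
  variable
    m n : ℕ

<⇒<ᵇ≡true : m < n → (m <ᵇ n) ≡ true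
<⇒<ᵇ≡true m<n = Equivalence.to T-≡ (<⇒<ᵇ m<n)

<ᵇ≡true⇒< : ∀ m n → (m <ᵇ n) ≡ true → m < n
<ᵇ≡true⇒< m n eq = <ᵇ⇒< m n (Equivalence.from T-≡ eq)

<ᵇ≡true⇒<ᵇsuc : ∀ m n → (m <ᵇ n) ≡ true → (m <ᵇ suc n) ≡ true
<ᵇ≡true⇒<ᵇsuc m n m<n = <⇒<ᵇ≡true (m<n⇒m<1+n (<ᵇ≡true⇒< m n m<n))

≮⇒<ᵇ≡false : m ≮ n → (m <ᵇ n) ≡ false
≮⇒<ᵇ≡false {m} {n} m≮n with m <ᵇ n in eq
... | true  = contradiction (<ᵇ≡true⇒< m n eq) m≮n
... | false = refl

pinnacles-peak : ∀ {a b c} r → a < b → c < b → pinnacles (a ∷ b ∷ c ∷ r) ≡ b ∷ pinnacles (b ∷ c ∷ r)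
pinnacles-peak r a<b c<b rewrite <⇒<ᵇ≡true a<b | <⇒<ᵇ≡true c<b = refl

pinnacles-¬ascent : ∀ {a b c} r → a ≮ b → pinnacles (a ∷ b ∷ c ∷ r) ≡ pinnacles (b ∷ c ∷ r)
pinnacles-¬ascent r a≮b rewrite ≮⇒<ᵇ≡false a≮b = refl

pinnacles-¬descent : ∀ {a b c} r → c ≮ b → pinnacles (a ∷ b ∷ c ∷ r) ≡ pinnacles (b ∷ c ∷ r)
pinnacles-¬descent {a} {b} r c≮b rewrite ≮⇒<ᵇ≡false c≮b | ∧-zeroʳ (a <ᵇ b) = refl

pinnacles-descent : ∀ {a b} r → b < a → pinnacles (a ∷ b ∷ r) ≡ pinnacles (b ∷ r)
pinnacles-descent []      _   = refl
pinnacles-descent (_ ∷ r) b<a = pinnacles-¬ascent r (<⇒≯ b<a)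

boolToℕ : Bool → ℕ
boolToℕ true  = 1
boolToℕ false = 0

countᵇ : (ℕ → Bool) → List ℕ → ℕ
countᵇ f []       = 0
countᵇ f (a ∷ as) = boolToℕ (f a) + countᵇ f as

#below #atMost : ℕ → List ℕ → ℕ
#below  X = countᵇ (_<ᵇ X)
#atMost X = countᵇ (_<ᵇ suc X)

countᵇ-↭ : ∀ f {xs ys} → xs ↭ ys → countᵇ f xs ≡ countᵇ f ys
countᵇ-↭ f ↭.refl         = refl
countᵇ-↭ f (↭.prep x p)   = cong (boolToℕ (f x) +_) (countᵇ-↭ f p)
countᵇ-↭ f (↭.swap x y p) = trans (swap-heads (boolToℕ (f x)) (boolToℕ (f y)) _)
  (cong (λ k → boolToℕ (f y) + (boolToℕ (f x) + k)) (countᵇ-↭ f p))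
  where
  swap-heads : ∀ i j k → i + (j + k) ≡ j + (i + k)
  swap-heads = solve-∀
countᵇ-↭ f (↭.trans p q)  = trans (countᵇ-↭ f p) (countᵇ-↭ f q)

countᵇ≤length : ∀ f xs → countᵇ f xs ≤ length xs
countᵇ≤length f []       = z≤n
countᵇ≤length f (a ∷ as) = +-mono-≤ (boolToℕ≤1 (f a)) (countᵇ≤length f as)
  where
  boolToℕ≤1 : ∀ b → boolToℕ b ≤ 1
  boolToℕ≤1 true  = ≤-refl
  boolToℕ≤1 false = z≤n

boolToℕ-mono : ∀ {x y} → (x ≡ true → y ≡ true) → boolToℕ x ≤ boolToℕ y
boolToℕ-mono {false} _   = z≤n
boolToℕ-mono {true}  x⇒y rewrite x⇒y refl = ≤-refl

countᵇ-mono : ∀ f g xs → (∀ m → f m ≡ true → g m ≡ true) → countᵇ f xs ≤ countᵇ g xs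
countᵇ-mono f g []       f⇒g = z≤n
countᵇ-mono f g (a ∷ as) f⇒g = +-mono-≤ (boolToℕ-mono (f⇒g a)) (countᵇ-mono f g as f⇒g)

-- Valleys of a permutation

-- The first bound is capped by q; a cap above X does not change which bounds are at most X.
valleyBounds : ℕ → List ℕ → List ℕ
valleyBounds q []       = q ∷ []
valleyBounds q (a ∷ os) = q ⊓ a ∷ valleyBounds a os

length-valleyBounds : ∀ q os → length (valleyBounds q os) ≡ suc (length os)
length-valleyBounds q []       = refl
length-valleyBounds q (a ∷ os) = cong suc (length-valleyBounds a os)

-- Invariant of a left-to-right scan of a ∷ w: q bounds the valley owed before the next pinnacle,
-- and f counts the entries below X already passed that have not paid for an earlier valley.
private
  ValleyCount : ℕ → ℕ → ℕ → ℕ → List ℕ → Set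
  ValleyCount X q f a w =
    #below X (pinnacles (a ∷ w)) + #atMost X (valleyBounds q (pinnacles (a ∷ w))) ≤ #below X (a ∷ w) + f

  charge : ∀ {q a X} f → (q ≤ X → a < X ⊎ 1 ≤ f) → boolToℕ (q <ᵇ suc X) ≤ boolToℕ (a <ᵇ X) + f
  charge {q} {a} {X} f pay with q <? suc X
  ... | no q≰X rewrite ≮⇒<ᵇ≡false q≰X = z≤n
  ... | yes q<1+X@(s≤s q≤X) rewrite <⇒<ᵇ≡true q<1+X with pay q≤X
  ...   | inj₁ a<X rewrite <⇒<ᵇ≡true a<X = s≤s z≤n
  ...   | inj₂ 1≤f = ≤-trans 1≤f (m≤n+m f _)

  valley-count-end : ∀ {X q f a} w → pinnacles (a ∷ w) ≡ [] → (q ≤ X → a < X ⊎ 1 ≤ f) →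
    ValleyCount X q f a w
  valley-count-end {X} {q} {f} w none pay rewrite none | +-identityʳ (boolToℕ (q <ᵇ suc X)) =
    ≤-trans (charge f pay) (+-monoˡ-≤ f (m≤m+n _ (#below X w)))

  credit : ∀ {q a b X f} → (q ≤ X → a < X ⊎ 1 ≤ f) → q ≤ X → b < X ⊎ 1 ≤ f + boolToℕ (a <ᵇ X)
  credit {f = f} pay q≤X with pay q≤X
  ... | inj₁ a<X rewrite <⇒<ᵇ≡true a<X = inj₂ (m≤n+m 1 f)
  ... | inj₂ 1≤f = inj₂ (≤-trans 1≤f (m≤m+n f _))

  bank : ∀ {L} A C f → L ≤ C + (f + A) → L ≤ A + C + f
  bank {L} A C f = subst (L ≤_) (e A C f)
    where
    e : ∀ A C f → C + (f + A) ≡ A + C + f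
    e = solve-∀

  valley-count-step : ∀ X q f a b c w → (q ≤ X → a < X ⊎ 1 ≤ f) →
    ((b ≤ X → c < X ⊎ 1 ≤ 0) → ValleyCount X b 0 c w) →
    ((q ≤ X → b < X ⊎ 1 ≤ f + boolToℕ (a <ᵇ X)) → ValleyCount X q (f + boolToℕ (a <ᵇ X)) b (c ∷ w)) →
    ValleyCount X q f a (b ∷ c ∷ w)
  valley-count-step X q f a b c w pay restart continue with a <? b | c <? b
  ... | yes a<b | yes c<b rewrite pinnacles-peak w a<b c<b | pinnacles-descent w c<b =
    rearrange (boolToℕ (b <ᵇ X)) (boolToℕ (a <ᵇ X)) (#below X (c ∷ w)) f
      (restart (λ b≤X → inj₁ (<-≤-trans c<b b≤X))) (charge f pay-peak)
    where
    pay-peak : q ⊓ b ≤ X → a < X ⊎ 1 ≤ f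
    pay-peak q⊓b≤X with ⊓-sel q b
    ... | inj₁ q⊓b≡q = pay (subst (_≤ X) q⊓b≡q q⊓b≤X)
    ... | inj₂ q⊓b≡b = inj₁ (<-≤-trans a<b (subst (_≤ X) q⊓b≡b q⊓b≤X))
    rearrange : ∀ {P K V} B A C f → P + V ≤ C + 0 → K ≤ A + f → B + P + (K + V) ≤ A + (B + C) + f
    rearrange {P} {K} {V} B A C f h₁ h₂ =
      subst₂ _≤_ (e₁ B P K V) (e₂ B C A f) (+-mono-≤ (+-monoʳ-≤ B h₁) h₂)
      where
      e₁ : ∀ B P K V → B + (P + V) + K ≡ B + P + (K + V)
      e₁ = solve-∀
      e₂ : ∀ B C A f → B + (C + 0) + (A + f) ≡ A + (B + C) + f
      e₂ = solve-∀
  ... | no a≮b | _ rewrite pinnacles-¬ascent {c = c} w a≮b =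
    bank (boolToℕ (a <ᵇ X)) (#below X (b ∷ c ∷ w)) f (continue (credit pay))
  ... | yes _ | no c≮b rewrite pinnacles-¬descent {a} w c≮b =
    bank (boolToℕ (a <ᵇ X)) (#below X (b ∷ c ∷ w)) f (continue (credit pay))

  valley-count-from : ∀ X q f a w → (q ≤ X → a < X ⊎ 1 ≤ f) → ValleyCount X q f a w
  valley-count-from X q f a []          pay = valley-count-end [] refl pay
  valley-count-from X q f a (b ∷ [])    pay = valley-count-end (b ∷ []) refl pay
  valley-count-from X q f a (b ∷ c ∷ w) pay = valley-count-step X q f a b c w pay
    (valley-count-from X b 0 c w) (valley-count-from X q (f + boolToℕ (a <ᵇ X)) b (c ∷ w))

valley-count : ∀ X w →
  #below X (pinnacles w) + #atMost X (valleyBounds (suc X) (pinnacles w)) ≤ #below X w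
valley-count X []      rewrite ≮⇒<ᵇ≡false (n≮n (suc X)) = z≤n
valley-count X (a ∷ w) = ≤-trans
  (valley-count-from X (suc X) 0 a w (λ 1+X≤X → contradiction 1+X≤X (n≮n X)))
  (≤-reflexive (+-identityʳ _))

downFrom₁ : ℕ → List ℕ
downFrom₁ = applyDownFrom suc

range1↭downFrom₁ : ∀ n → range1 n ↭ downFrom₁ n
range1↭downFrom₁ zero    = ↭-refl
range1↭downFrom₁ (suc n) = ↭-trans (↭.++-comm (range1 n) (suc n ∷ [])) (↭-prep (suc n) (range1↭downFrom₁ n))

#below-downFrom₁ : ∀ X n → #below X (downFrom₁ n) ≤ pred X
#below-downFrom₁ X zero    = z≤n
#below-downFrom₁ X (suc n) with suc n <? X
... | no n+1≮X rewrite ≮⇒<ᵇ≡false n+1≮X = #below-downFrom₁ X n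
... | yes n+1<X rewrite <⇒<ᵇ≡true n+1<X =
  ≤-trans (s≤s (≤-trans (countᵇ≤length (_<ᵇ X) (downFrom₁ n)) (≤-reflexive (length-applyDownFrom suc n))))
          (<⇒≤pred n+1<X)

permutation-valley-count : ∀ X {n w} → IsPermOf n w →
  #below X (pinnacles w) + #atMost X (valleyBounds (suc X) (pinnacles w)) ≤ pred X
permutation-valley-count X {n} {w} w↭[n] = ≤-trans (valley-count X w)
  (≤-trans (≤-reflexive (countᵇ-↭ (_<ᵇ X) (↭-trans w↭[n] (range1↭downFrom₁ n)))) (#below-downFrom₁ X n))

-- Greedy matching under Hall's condition

countBelow : (ℕ → Bool) → ℕ → ℕ
countBelow U zero    = 0
countBelow U (suc X) = countBelow U X + boolToℕ (U X)

LargestBelow : (ℕ → Bool) → ℕ → Set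
LargestBelow U t = Σ ℕ λ u → U u ≡ true × u < t × (∀ m → u < m → m < t → U m ≡ false)

largestBelow : ∀ U t → 1 ≤ countBelow U t → LargestBelow U t
largestBelow U (suc t) 1≤count with U t in Ut
... | true  = t , Ut , ≤-refl , λ m t<m m<1+t → contradiction (≤-pred m<1+t) (<⇒≱ t<m)
... | false with largestBelow U t (≤-trans 1≤count (≤-reflexive (+-identityʳ _)))
...   | u , Uu , u<t , gap = u , Uu , m<n⇒m<1+n u<t , gap′
  where
  gap′ : ∀ m → u < m → m < suc t → U m ≡ false
  gap′ m u<m (s≤s m≤t) with m≤n⇒m<n∨m≡n m≤t
  ... | inj₁ m<t  = gap m u<m m<t
  ... | inj₂ refl = Ut

except : (ℕ → Bool) → ℕ → ℕ → Bool
except U u m with m ≟ u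
... | yes _ = false
... | no  _ = U m

except-sound : ∀ U u m → except U u m ≡ true → U m ≡ true × m ≢ u
except-sound U u m eq with m ≟ u
... | no m≢u = eq , m≢u

countBelow-except : ∀ U u → U u ≡ true → ∀ X → countBelow (except U u) X + boolToℕ (u <ᵇ X) ≡ countBelow U X
countBelow-except U u Uu zero = refl
countBelow-except U u Uu (suc X) with X ≟ u | countBelow-except U u Uu X
... | yes refl | ih rewrite <⇒<ᵇ≡true (n<1+n X) | ≮⇒<ᵇ≡false (n≮n X) | Uu =
  cong (_+ 1) ih
... | no X≢u | ih with u <? X
...   | yes u<X rewrite <⇒<ᵇ≡true (m<n⇒m<1+n u<X) | <⇒<ᵇ≡true u<X =
  trans (e (countBelow (except U u) X) (boolToℕ (U X))) (cong (_+ boolToℕ (U X)) ih)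
  where
  e : ∀ k l → k + l + 1 ≡ k + 1 + l
  e = solve-∀
...   | no u≮X rewrite ≮⇒<ᵇ≡false (λ u<1+X → u≮X (≤∧≢⇒< (≤-pred u<1+X) (X≢u ∘ sym))) | ≮⇒<ᵇ≡false u≮X =
  trans (e (countBelow (except U u) X) (boolToℕ (U X))) (cong (_+ boolToℕ (U X)) ih)
  where
  e : ∀ k l → k + l + 0 ≡ k + 0 + l
  e = solve-∀

countBelow-gap : ∀ U {X t} → (∀ m → X ≤ m → m < t → U m ≡ false) → X ≤ t → countBelow U X ≡ countBelow U t
countBelow-gap U {t = zero}  gap z≤n = refl
countBelow-gap U {t = suc t} gap X≤1+t with m≤n⇒m<n∨m≡n X≤1+t
... | inj₂ refl = refl
... | inj₁ (s≤s X≤t) rewrite gap t X≤t ≤-refl =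
  trans (countBelow-gap U (λ m X≤m m<t → gap m X≤m (m<n⇒m<1+n m<t)) X≤t) (sym (+-identityʳ _))

HallCondition : List ℕ → (ℕ → Bool) → Set
HallCondition ts U = ∀ X → #atMost X ts ≤ countBelow U X

HallCondition-except : ∀ t ts U u → U u ≡ true → u < t → (∀ m → u < m → m < t → U m ≡ false) →
  HallCondition (t ∷ ts) U → HallCondition ts (except U u)
HallCondition-except t ts U u Uu u<t gap hall X with t ≤? X
... | yes t≤X = +-cancelʳ-≤ 1 _ _ (begin
  #atMost X ts + 1                             ≡⟨ +-comm _ 1 ⟩
  1 + #atMost X ts                             ≡⟨ cong (λ b → boolToℕ b + #atMost X ts) (<⇒<ᵇ≡true (s≤s t≤X)) ⟨
  #atMost X (t ∷ ts)                           ≤⟨ hall X ⟩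
  countBelow U X                               ≡⟨ countBelow-except U u Uu X ⟨
  countBelow (except U u) X + boolToℕ (u <ᵇ X) ≡⟨ cong (λ b → remaining + boolToℕ b) (<⇒<ᵇ≡true u<X) ⟩
  remaining + 1                                ∎)
  where
  open ≤-Reasoning
  remaining = countBelow (except U u) X
  u<X = <-≤-trans u<t t≤X
... | no t≰X with u <? X
...   | no u≮X = begin
  #atMost X ts                                 ≤⟨ m≤n+m _ _ ⟩
  #atMost X (t ∷ ts)                           ≤⟨ hall X ⟩
  countBelow U X                               ≡⟨ countBelow-except U u Uu X ⟨
  countBelow (except U u) X + boolToℕ (u <ᵇ X) ≡⟨ cong (remaining +_) (cong boolToℕ (≮⇒<ᵇ≡false u≮X)) ⟩
  remaining + 0                                ≡⟨ +-identityʳ remaining ⟩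
  remaining                                    ∎
  where
  open ≤-Reasoning
  remaining = countBelow (except U u) X
...   | yes u<X = +-cancelʳ-≤ 1 _ _ (begin
  #atMost X ts + 1                             ≤⟨ #atMost-step ⟩
  #atMost t (t ∷ ts)                           ≤⟨ hall t ⟩
  countBelow U t                               ≡⟨ countBelow-gap U (λ m X≤m → gap m (<-≤-trans u<X X≤m)) (<⇒≤ X<t) ⟨
  countBelow U X                               ≡⟨ countBelow-except U u Uu X ⟨
  countBelow (except U u) X + boolToℕ (u <ᵇ X) ≡⟨ cong (remaining +_) (cong boolToℕ (<⇒<ᵇ≡true u<X)) ⟩
  remaining + 1                                ∎)
  where
  open ≤-Reasoning
  remaining = countBelow (except U u) X
  X<t = ≰⇒> t≰X
  #atMost-step : #atMost X ts + 1 ≤ #atMost t (t ∷ ts)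
  #atMost-step rewrite <⇒<ᵇ≡true (n<1+n t) =
    subst (_≤ 1 + #atMost t ts) (+-comm 1 _) (s≤s (countᵇ-mono (_<ᵇ suc X) (_<ᵇ suc t) ts
      (λ m m≤X → <⇒<ᵇ≡true (≤-trans (<ᵇ≡true⇒< m (suc X) m≤X) (s≤s (<⇒≤ X<t))))))

-- Matching the first threshold with the largest admissible value below it preserves Hall's condition.
greedy-matching : ∀ ts U → HallCondition ts U →
  Σ (List ℕ) λ vs → Pointwise _<_ vs ts × All (λ v → U v ≡ true) vs × Unique vs
greedy-matching []       U hall = [] , [] , [] , []
greedy-matching (t ∷ ts) U hall with largestBelow U t (≤-trans 1≤#atMost (hall t))
  where
  1≤#atMost : 1 ≤ #atMost t (t ∷ ts)
  1≤#atMost rewrite <⇒<ᵇ≡true (n<1+n t) = s≤s z≤n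
... | u , Uu , u<t , gap with greedy-matching ts (except U u) (HallCondition-except t ts U u Uu u<t gap hall)
...   | vs , vs<ts , allU , unique =
  u ∷ vs , u<t ∷ vs<ts ,
  Uu ∷ All.map (λ {v} e → proj₁ (except-sound U u v e)) allU ,
  All.map (λ {v} e u≡v → proj₂ (except-sound U u v e) (sym u≡v)) allU ∷ unique

-- Permutations with a prescribed pinnacle order

valleyBounds∞ : List ℕ → List ℕ
valleyBounds∞ []       = []
valleyBounds∞ (a ∷ os) = a ∷ valleyBounds a os

#atMost-valleyBounds : ∀ X a os →
  #atMost X (valleyBounds a os) + boolToℕ (a <ᵇ suc X) ≤ 2 * (boolToℕ (a <ᵇ suc X) + #atMost X os)
#atMost-valleyBounds X a [] = ≤-reflexive (e (boolToℕ (a <ᵇ suc X)))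
  where
  e : ∀ A → A + 0 + A ≡ 2 * (A + 0)
  e = solve-∀
#atMost-valleyBounds X a (b ∷ os) =
  ≤-trans (+-monoˡ-≤ (boolToℕ (a <ᵇ suc X)) (+-monoˡ-≤ (#atMost X (valleyBounds b os)) (⊓-atMost a b)))
    (rearrange (boolToℕ (a <ᵇ suc X)) (boolToℕ (b <ᵇ suc X)) (#atMost X (valleyBounds b os)) (#atMost X os)
      (#atMost-valleyBounds X b os))
  where
  ⊓-atMost : ∀ a b → boolToℕ (a ⊓ b <ᵇ suc X) ≤ boolToℕ (a <ᵇ suc X) + boolToℕ (b <ᵇ suc X)
  ⊓-atMost a b with ⊓-sel a b
  ... | inj₁ a⊓b≡a rewrite a⊓b≡a = m≤m+n _ _
  ... | inj₂ a⊓b≡b rewrite a⊓b≡b = m≤n+m _ _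
  rearrange : ∀ A B V C → V + B ≤ 2 * (B + C) → A + B + V + A ≤ 2 * (A + (B + C))
  rearrange A B V C h = subst₂ _≤_ (e₁ A B V) (e₂ A B C) (+-monoʳ-≤ (2 * A) h)
    where
    e₁ : ∀ A B V → 2 * A + (V + B) ≡ A + B + V + A
    e₁ = solve-∀
    e₂ : ∀ A B C → 2 * A + 2 * (B + C) ≡ 2 * (A + (B + C))
    e₂ = solve-∀

#atMost-valleyBounds∞≤double : ∀ X os → #atMost X (valleyBounds∞ os) ≤ 2 * #atMost X os
#atMost-valleyBounds∞≤double X []       = z≤n
#atMost-valleyBounds∞≤double X (a ∷ os) =
  subst (_≤ 2 * #atMost X (a ∷ os)) (+-comm _ (boolToℕ (a <ᵇ suc X))) (#atMost-valleyBounds X a os)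

#atMost-valleyBounds∞≤1+length : ∀ X os → #atMost X (valleyBounds∞ os) ≤ suc (length os)
#atMost-valleyBounds∞≤1+length X []       = z≤n
#atMost-valleyBounds∞≤1+length X (a ∷ os) =
  ≤-trans (countᵇ≤length _ (valleyBounds∞ (a ∷ os))) (s≤s (≤-reflexive (length-valleyBounds a os)))

weave : List ℕ → List ℕ → List ℕ
weave []       _        = []
weave (v ∷ vs) []       = v ∷ []
weave (v ∷ vs) (o ∷ os) = v ∷ o ∷ weave vs os

weave↭++ : ∀ vs os → length vs ≡ suc (length os) → weave vs os ↭ vs ++ os
weave↭++ (v ∷ [])    []       _  = ↭-refl
weave↭++ (v ∷ vs)    (o ∷ os) eq =
  ↭-prep v (↭-trans (↭-prep o (weave↭++ vs os (suc-injective eq))) (↭-sym (↭.shift o vs os)))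

pinnacles-weave : ∀ {v a} os vs → v < a → Pointwise _<_ vs (valleyBounds a os) →
  pinnacles (weave (v ∷ vs) (a ∷ os)) ≡ a ∷ os
pinnacles-weave []       (v′ ∷ []) v<a (v′<a ∷ []) = pinnacles-peak [] v<a v′<a
pinnacles-weave {a = a} (b ∷ os) (v′ ∷ vs) v<a (v′<a⊓b ∷ vs<bounds) = begin
  pinnacles (_ ∷ a ∷ v′ ∷ b ∷ weave vs os)  ≡⟨ pinnacles-peak (b ∷ weave vs os) v<a v′<a ⟩
  a ∷ pinnacles (a ∷ v′ ∷ b ∷ weave vs os)  ≡⟨ cong (a ∷_) (pinnacles-descent (b ∷ weave vs os) v′<a) ⟩
  a ∷ pinnacles (weave (v′ ∷ vs) (b ∷ os))  ≡⟨ cong (a ∷_) (pinnacles-weave os vs v′<b vs<bounds) ⟩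
  a ∷ b ∷ os                                ∎
  where
  open ≡-Reasoning
  v′<a = <-≤-trans v′<a⊓b (m⊓n≤m a b)
  v′<b = <-≤-trans v′<a⊓b (m⊓n≤n a b)

pinnacles-descending-++ : ∀ {v a} ds rest → AllPairs _>_ ds → v < a →
  pinnacles (ds ++ v ∷ a ∷ rest) ≡ pinnacles (v ∷ a ∷ rest)
pinnacles-descending-++ []            rest _  _   = refl
pinnacles-descending-++ (d ∷ [])      rest _  v<a = pinnacles-¬descent rest (<⇒≯ v<a)
pinnacles-descending-++ (d ∷ d′ ∷ ds) rest ((d′<d ∷ _) ∷ desc) v<a =
  trans (pinnacles-descent (ds ++ _ ∷ _ ∷ rest) d′<d) (pinnacles-descending-++ (d′ ∷ ds) rest desc v<a)

lowerBound : ℕ → ℕ → ℕ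
lowerBound p i = (2 * i) ⊓ suc p + i

lowerBound≡ : ∀ p i → lowerBound p i ≡ (p + i + 1) ⊓ (3 * i)
lowerBound≡ p i = trans (+-distribʳ-⊓ i (2 * i) (suc p)) (trans (⊓-comm _ _) (cong₂ _⊓_ (e₁ p i) (e₂ i)))
  where
  e₁ : ∀ p i → suc p + i ≡ p + i + 1
  e₁ = solve-∀
  e₂ : ∀ i → 2 * i + i ≡ 3 * i
  e₂ = solve-∀

MeetsLowerBoundsFrom : ℕ → ℕ → List ℕ → Set
MeetsLowerBoundsFrom p i []       = ⊤
MeetsLowerBoundsFrom p i (s ∷ ss) = lowerBound p (suc i) ≤ s × MeetsLowerBoundsFrom p (suc i) ss

#atMost-above : ∀ X ss → All (X <_) ss → #atMost X ss ≡ 0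
#atMost-above X []       []           = refl
#atMost-above X (s ∷ ss) (X<s ∷ X<ss) rewrite ≮⇒<ᵇ≡false (<⇒≱ (s≤s X<s)) = #atMost-above X ss X<ss

#below≤#atMost : ∀ X ss → #below X ss ≤ #atMost X ss
#below≤#atMost X ss = countᵇ-mono (_<ᵇ X) (_<ᵇ suc X) ss (λ m → <ᵇ≡true⇒<ᵇsuc m X)

#below<#atMost : ∀ X ss → X ∈ ss → #below X ss < #atMost X ss
#below<#atMost X (_ ∷ ss) (here refl) rewrite ≮⇒<ᵇ≡false (n≮n X) | <⇒<ᵇ≡true (n<1+n X) =
  s≤s (#below≤#atMost X ss)
#below<#atMost X (s ∷ ss) (there X∈ss) =
  +-mono-≤-< (boolToℕ-mono (<ᵇ≡true⇒<ᵇsuc s X)) (#below<#atMost X ss X∈ss)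

#atMost≡0⇒#below≡0 : ∀ X ss → #atMost X ss ≡ 0 → #below X ss ≡ 0
#atMost≡0⇒#below≡0 X ss none = n≤0⇒n≡0 (subst (#below X ss ≤_) none
  (#below≤#atMost X ss))

#atMost-pos⇒< : ∀ X s ss → 1 ≤ #atMost X ss → All (s <_) ss → s < X
#atMost-pos⇒< X s (t ∷ ts) pos (s<t ∷ s<ts) with t <? suc X
... | yes (s≤s t≤X) = <-≤-trans s<t t≤X
... | no  t≰X rewrite ≮⇒<ᵇ≡false t≰X = #atMost-pos⇒< X s ts pos s<ts

-- The induction stops at the largest s ≤ X in ss, the (i + #atMost X ss)-th element: its lower bound gives room.
lowerBounds⇒room : ∀ p i ss → AllPairs _<_ ss → MeetsLowerBoundsFrom p i ss → ∀ X → 1 ≤ #atMost X ss →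
  (2 * (i + #atMost X ss)) ⊓ suc p + i + #below X ss ≤ pred X
lowerBounds⇒room p i (s ∷ ss) (s<ss ∷ sorted) (s≥ , ss≥) X pos with s <? suc X
... | no s≰X rewrite ≮⇒<ᵇ≡false s≰X
                   | #atMost-above X ss (All.map (<-trans (≰⇒> (s≰X ∘ s≤s))) s<ss) = contradiction pos λ ()
... | yes s<1+X rewrite <⇒<ᵇ≡true s<1+X with #atMost X ss in c
...   | suc c′ rewrite <⇒<ᵇ≡true (#atMost-pos⇒< X s ss (subst (1 ≤_) (sym c) (s≤s z≤n)) s<ss) =
  subst (_≤ pred X) (shift (#below X ss))
    (subst (λ k → (2 * (suc i + k)) ⊓ suc p + suc i + #below X ss ≤ pred X) c
      (lowerBounds⇒room p (suc i) ss sorted ss≥ X 1≤c))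
  where
  1≤c : 1 ≤ #atMost X ss
  1≤c = subst (1 ≤_) (sym c) (s≤s z≤n)
  shift : ∀ B → (2 * (suc i + suc c′)) ⊓ suc p + suc i + B ≡ (2 * (i + suc (suc c′))) ⊓ suc p + i + (1 + B)
  shift B = trans (cong (λ k → (2 * k) ⊓ suc p + suc i + B) (sym (+-suc i (suc c′)))) (e _ i B)
    where
    e : ∀ M i B → M + suc i + B ≡ M + i + (1 + B)
    e = solve-∀
...   | zero rewrite #atMost≡0⇒#below≡0 X ss c | +-comm i 1 with s <? X
...     | yes s<X rewrite <⇒<ᵇ≡true s<X =
  ≤-trans (≤-reflexive (e ((2 * suc i) ⊓ suc p) i)) (≤-trans s≥ (<⇒≤pred s<X))
  where
  e : ∀ M i → M + i + (1 + 0) ≡ M + suc i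
  e = solve-∀
...     | no s≮X rewrite ≮⇒<ᵇ≡false s≮X | ≤-antisym (≤-pred s<1+X) (≮⇒≥ s≮X)
                     | +-identityʳ ((2 * suc i) ⊓ suc p + i) = <⇒≤pred (subst (_≤ X) (+-suc _ i) s≥)

isFreeFor : List ℕ → ℕ → Bool
isFreeFor ss zero    = false
isFreeFor ss (suc m) = does (suc m ∉? ss)

isFreeFor-sound : ∀ ss m → isFreeFor ss m ≡ true → 1 ≤ m × m ∉ ss
isFreeFor-sound ss (suc m) free with suc m ∈? ss
... | no m∉ss = s≤s z≤n , m∉ss

pred≤countBelow-isFreeFor : ∀ ss X → pred X ≤ countBelow (isFreeFor ss) X + #below X ss
pred≤countBelow-isFreeFor ss zero          = z≤n
pred≤countBelow-isFreeFor ss (suc zero)    = z≤n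
pred≤countBelow-isFreeFor ss (suc (suc Y)) with suc Y ∈? ss | pred≤countBelow-isFreeFor ss (suc Y)
... | yes Y+1∈ss | ih = ≤-trans (s≤s ih) (≤-trans
  (≤-reflexive (sym (+-suc F (#below (suc Y) ss))))
  (+-mono-≤ (≤-reflexive (sym (+-identityʳ F))) (#below<#atMost (suc Y) ss Y+1∈ss)))
  where
  F = countBelow (isFreeFor ss) (suc Y)
... | no  _      | ih = ≤-trans (s≤s ih) (≤-trans
  (≤-reflexive (e F (#below (suc Y) ss)))
  (+-monoʳ-≤ (F + 1) (#below≤#atMost (suc Y) ss)))
  where
  F = countBelow (isFreeFor ss) (suc Y)
  e : ∀ F B → suc (F + B) ≡ F + 1 + B
  e = solve-∀

HallCondition-valleyBounds∞ : ∀ p ss os → AllPairs _<_ ss → MeetsLowerBoundsFrom p 0 ss → os ↭ ss →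
  length ss ≡ p → HallCondition (valleyBounds∞ os) (isFreeFor ss)
HallCondition-valleyBounds∞ p ss os sorted bounds os↭ss length≡p X =
  ≤-trans (⊓-glb (#atMost-valleyBounds∞≤double X os) (#atMost-valleyBounds∞≤1+length X os))
    (subst₂ (λ c l → (2 * c) ⊓ suc l ≤ countBelow (isFreeFor ss) X)
      (sym (countᵇ-↭ (_<ᵇ suc X) os↭ss)) (sym (trans (↭.↭-length os↭ss) length≡p)) room)
  where
  room : (2 * #atMost X ss) ⊓ suc p ≤ countBelow (isFreeFor ss) X
  room with #atMost X ss in c
  ... | zero  = z≤n
  ... | suc _ = +-cancelʳ-≤ (#below X ss) _ _
    (≤-trans (≤-reflexive (cong (_+ #below X ss) (sym (+-identityʳ _))))
    (≤-trans (subst (λ k → (2 * k) ⊓ suc p + 0 + #below X ss ≤ pred X) c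
      (lowerBounds⇒room p 0 ss sorted bounds X (subst (1 ≤_) (sym c) (s≤s z≤n))))
    (pred≤countBelow-isFreeFor ss X)))

downFrom₁-descending : ∀ n → AllPairs _>_ (downFrom₁ n)
downFrom₁-descending zero    = []
downFrom₁-descending (suc n) = All.tabulate (λ z∈ → s≤s (below z∈)) ∷ downFrom₁-descending n
  where
  below : ∀ {z} → z ∈ downFrom₁ n → z ≤ n
  below z∈ with _ , i<n , refl ← ∈-applyDownFrom⁻ suc z∈ = i<n

∈-downFrom₁⁺ : ∀ {z n} → 1 ≤ z → z ≤ n → z ∈ downFrom₁ n
∈-downFrom₁⁺ {suc z} _ z<n = ∈-applyDownFrom⁺ suc z<n

∈-downFrom₁⁻ : ∀ {z n} → z ∈ downFrom₁ n → 1 ≤ z × z ≤ n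
∈-downFrom₁⁻ z∈ with _ , i<n , refl ← ∈-applyDownFrom⁻ suc z∈ = s≤s z≤n , i<n

↭-downFrom₁ : ∀ {w} N → Unique w → (∀ {z} → z ∈ w → 1 ≤ z × z ≤ N) → (∀ {z} → 1 ≤ z → z ≤ N → z ∈ w) →
  w ↭ downFrom₁ N
↭-downFrom₁ N unique inside covers = ∼bag⇒↭ (unique∧set⇒bag unique
  (AllPairs.map (λ z>y z≡y → <-irrefl (sym z≡y) z>y) (downFrom₁-descending N))
  (mk⇔ (λ z∈w → uncurry ∈-downFrom₁⁺ (inside z∈w)) (λ z∈ → uncurry covers (∈-downFrom₁⁻ z∈))))

∈⇒≤sum : ∀ {z} ss → z ∈ ss → z ≤ sum ss
∈⇒≤sum (s ∷ ss) (here refl) = m≤m+n s (sum ss)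
∈⇒≤sum (s ∷ ss) (there z∈) = ≤-trans (∈⇒≤sum ss z∈) (m≤n+m (sum ss) s)

valleyBounds-≤ : ∀ N q os → q ≤ N → All (_≤ N) os → All (_≤ N) (valleyBounds q os)
valleyBounds-≤ N q []       q≤N []             = q≤N ∷ []
valleyBounds-≤ N q (a ∷ os) q≤N (a≤N ∷ os≤N) = ≤-trans (m⊓n≤m q a) q≤N ∷ valleyBounds-≤ N a os a≤N os≤N

MeetsLowerBoundsFrom⇒positive : ∀ p i ss → MeetsLowerBoundsFrom p i ss → All (1 ≤_) ss
MeetsLowerBoundsFrom⇒positive p i []       _          = []
MeetsLowerBoundsFrom⇒positive p i (s ∷ ss) (s≥ , ss≥) =
  ≤-trans (s≤s z≤n) (≤-trans (m≤n+m (suc i) ((2 * suc i) ⊓ suc p)) s≥) ∷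
  MeetsLowerBoundsFrom⇒positive p (suc i) ss ss≥

missingFrom : ℕ → List ℕ → List ℕ
missingFrom N u = filter (_∉? u) (downFrom₁ N)

missingFrom-descending : ∀ N u → AllPairs _>_ (missingFrom N u)
missingFrom-descending N u = AllPairs.filter⁺ (_∉? u) (downFrom₁-descending N)

missingFrom-++-↭ : ∀ N u → Unique u → All (λ z → 1 ≤ z × z ≤ N) u → missingFrom N u ++ u ↭ downFrom₁ N
missingFrom-++-↭ N u unique-u u⊆[N] = ↭-downFrom₁ N
  (Unique.++⁺ (AllPairs.map (λ z>y z≡y → <-irrefl (sym z≡y) z>y) (missingFrom-descending N u)) unique-u
    λ (z∈missing , z∈u) → proj₂ (∈-filter⁻ (_∉? u) {xs = downFrom₁ N} z∈missing) z∈u)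
  inside covers
  where
  inside : ∀ {z} → z ∈ missingFrom N u ++ u → 1 ≤ z × z ≤ N
  inside z∈ with ∈-++⁻ (missingFrom N u) z∈
  ... | inj₁ z∈missing = ∈-downFrom₁⁻ (proj₁ (∈-filter⁻ (_∉? u) {xs = downFrom₁ N} z∈missing))
  ... | inj₂ z∈u       = All.lookup u⊆[N] z∈u
  covers : ∀ {z} → 1 ≤ z → z ≤ N → z ∈ missingFrom N u ++ u
  covers {z} 1≤z z≤N with z ∈? u
  ... | yes z∈u = ∈-++⁺ʳ (missingFrom N u) z∈u
  ... | no  z∉u = ∈-++⁺ˡ (∈-filter⁺ (_∉? u) (∈-downFrom₁⁺ 1≤z z≤N) z∉u)

Pointwise-<-bounded : ∀ {N vs ts} → Pointwise _<_ vs ts → All (_≤ N) ts → All (_≤ N) vs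
Pointwise-<-bounded []            []           = []
Pointwise-<-bounded (v<t ∷ vs<ts) (t≤N ∷ ts≤N) = <⇒≤ (<-≤-trans v<t t≤N) ∷ Pointwise-<-bounded vs<ts ts≤N

Unique-resp-↭ : ∀ {xs ys : List ℕ} → xs ↭ ys → Unique xs → Unique ys
Unique-resp-↭ xs↭ys = ↭ₛ.Unique-resp-↭ (↭.↭⇒↭ₛ xs↭ys)

-- The valleys come from the matching; every other value up to N is placed, decreasingly, in front.
realise-ordering : ∀ p ss os → AllPairs _<_ ss → MeetsLowerBoundsFrom p 0 ss → os ↭ ss → length ss ≡ p →
  ∃ λ N → Σ (List ℕ) λ w → IsPermOf N w × pinnacles w ≡ os
realise-ordering p ss []       _      _      _     _        = 0 , [] , ↭-refl , refl
realise-ordering p ss (a ∷ os) sorted bounds os↭ss length≡p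
  with greedy-matching (valleyBounds∞ (a ∷ os)) (isFreeFor ss)
         (HallCondition-valleyBounds∞ p ss (a ∷ os) sorted bounds os↭ss length≡p)
... | v ∷ vs , v<a ∷ vs<bounds , free , unique-valleys =
  N , missingFrom N u ++ u ,
  ↭-trans (missingFrom-++-↭ N u unique-u u⊆[N]) (↭-sym (range1↭downFrom₁ N)) ,
  trans (pinnacles-descending-++ (missingFrom N u) (weave vs os) (missingFrom-descending N u) v<a)
        (pinnacles-weave os vs v<a vs<bounds)
  where
  N = sum ss
  u = weave (v ∷ vs) (a ∷ os)
  u↭ : u ↭ (v ∷ vs) ++ (a ∷ os)
  u↭ = weave↭++ (v ∷ vs) (a ∷ os)
    (trans (Pointwise-length (v<a ∷ vs<bounds)) (cong suc (length-valleyBounds a os)))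
  unique-u : Unique u
  unique-u = Unique-resp-↭ (↭-sym u↭) (Unique.++⁺ unique-valleys
    (Unique-resp-↭ (↭-sym os↭ss) (AllPairs.map (λ s<t s≡t → <-irrefl s≡t s<t) sorted))
    λ (z∈vs , z∈os) → proj₂ (isFreeFor-sound ss _ (All.lookup free z∈vs)) (↭.∈-resp-↭ os↭ss z∈os))
  os⊆[N] : All (λ z → 1 ≤ z × z ≤ N) (a ∷ os)
  os⊆[N] = ↭.All-resp-↭ (↭-sym os↭ss)
    (All.zipWith (uncurry _,_) (MeetsLowerBoundsFrom⇒positive p 0 ss bounds , All.tabulate (∈⇒≤sum ss)))
  valleys≤N : All (_≤ N) (v ∷ vs)
  valleys≤N = Pointwise-<-bounded (v<a ∷ vs<bounds) valleyBounds∞-≤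
    where
    os≤N = All.map proj₂ os⊆[N]
    valleyBounds∞-≤ : All (_≤ N) (valleyBounds∞ (a ∷ os))
    valleyBounds∞-≤ = All.head os≤N ∷ valleyBounds-≤ N a os (All.head os≤N) (All.tail os≤N)
  u⊆[N] : All (λ z → 1 ≤ z × z ≤ N) u
  u⊆[N] = ↭.All-resp-↭ (↭-sym u↭) (All.++⁺
    (All.zipWith (uncurry _,_) (All.map (λ isFree → proj₁ (isFreeFor-sound ss _ isFree)) free , valleys≤N))
    os⊆[N])

module _ {m a} {x : Vec ℕ m} (increasing : StrictlyIncreasing (a ∷ x)) where

  StrictlyIncreasing-tail : StrictlyIncreasing x
  StrictlyIncreasing-tail i j i<j = increasing (fsuc i) (fsuc j) (s≤s i<j)

  StrictlyIncreasing-head : ∀ k → a < lookup x k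
  StrictlyIncreasing-head k = increasing fzero (fsuc k) (s≤s z≤n)

All-toList : ∀ {m} {P : ℕ → Set} (x : Vec ℕ m) → (∀ k → P (lookup x k)) → All P (toList x)
All-toList []      Px = []
All-toList (a ∷ x) Px = Px fzero ∷ All-toList x (Px ∘ fsuc)

lookup∈toList : ∀ {m} (x : Vec ℕ m) k → lookup x k ∈ toList x
lookup∈toList (a ∷ x) fzero    = here refl
lookup∈toList (a ∷ x) (fsuc k) = there (lookup∈toList x k)

StrictlyIncreasing⇒sorted : ∀ {m} (x : Vec ℕ m) → StrictlyIncreasing x → AllPairs _<_ (toList x)
StrictlyIncreasing⇒sorted []      _          = []
StrictlyIncreasing⇒sorted (a ∷ x) increasing =
  All-toList x (StrictlyIncreasing-head increasing) ∷ StrictlyIncreasing⇒sorted x (StrictlyIncreasing-tail increasing)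

StrictlyIncreasing-mono : ∀ {m} (x : Vec ℕ m) → StrictlyIncreasing x → ∀ j k → toℕ j ≤ toℕ k → lookup x j ≤ lookup x k
StrictlyIncreasing-mono x increasing j k j≤k with m≤n⇒m<n∨m≡n j≤k
... | inj₁ j<k = <⇒≤ (increasing j k j<k)
... | inj₂ j≡k = ≤-reflexive (cong (lookup x) (toℕ-injective j≡k))

#below-lookup : ∀ {m} (x : Vec ℕ m) → StrictlyIncreasing x → ∀ k → #below (lookup x k) (toList x) ≡ toℕ k
#below-lookup (a ∷ x) increasing fzero rewrite ≮⇒<ᵇ≡false (n≮n a) =
  #atMost≡0⇒#below≡0 a (toList x) (#atMost-above a (toList x) (All-toList x (StrictlyIncreasing-head increasing)))
#below-lookup (a ∷ x) increasing (fsuc k) rewrite <⇒<ᵇ≡true (StrictlyIncreasing-head increasing k) =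
  cong suc (#below-lookup x (StrictlyIncreasing-tail increasing) k)

take-≤-lookup : ∀ {m} (x : Vec ℕ m) → StrictlyIncreasing x →
  ∀ k → All (_≤ lookup x k) (take (suc (toℕ k)) (toList x))
take-≤-lookup (a ∷ x) increasing fzero    = ≤-refl ∷ []
take-≤-lookup (a ∷ x) increasing (fsuc k) =
  <⇒≤ (StrictlyIncreasing-head increasing k) ∷ take-≤-lookup x (StrictlyIncreasing-tail increasing) k

drop->-lookup : ∀ {m} (x : Vec ℕ m) → StrictlyIncreasing x →
  ∀ k → All (lookup x k <_) (drop (suc (toℕ k)) (toList x))
drop->-lookup (a ∷ x) increasing fzero    = All-toList x (StrictlyIncreasing-head increasing)
drop->-lookup (a ∷ x) increasing (fsuc k) = drop->-lookup x (StrictlyIncreasing-tail increasing) k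

length-take-toList : ∀ {m} (x : Vec ℕ m) (k : Fin m) → length (take (suc (toℕ k)) (toList x)) ≡ suc (toℕ k)
length-take-toList (a ∷ x) fzero    = refl
length-take-toList (a ∷ x) (fsuc k) = cong suc (length-take-toList x k)

lookup-bounds⇒MeetsLowerBoundsFrom : ∀ p i {m} (x : Vec ℕ m) →
  (∀ k → lowerBound p (suc (i + toℕ k)) ≤ lookup x k) → MeetsLowerBoundsFrom p i (toList x)
lookup-bounds⇒MeetsLowerBoundsFrom p i []      _      = tt
lookup-bounds⇒MeetsLowerBoundsFrom p i (a ∷ x) bounds =
  subst (λ j → lowerBound p (suc j) ≤ a) (+-identityʳ i) (bounds fzero) ,
  lookup-bounds⇒MeetsLowerBoundsFrom p (suc i) x
    (λ k → subst (λ j → lowerBound p (suc j) ≤ lookup x k) (+-suc i (toℕ k)) (bounds (fsuc k)))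

interleave : List ℕ → List ℕ → List ℕ
interleave []       bs       = bs
interleave (s ∷ ss) []       = s ∷ ss
interleave (s ∷ ss) (b ∷ bs) = s ∷ b ∷ interleave ss bs

interleave↭++ : ∀ ss bs → interleave ss bs ↭ ss ++ bs
interleave↭++ []       bs       = ↭-refl
interleave↭++ (s ∷ ss) []       = ↭-reflexive (cong (s ∷_) (sym (++-identityʳ ss)))
interleave↭++ (s ∷ ss) (b ∷ bs) = ↭-prep s (↭-trans (↭-prep b (interleave↭++ ss bs)) (↭-sym (↭.shift b ss bs)))

#atMost≡length : ∀ X ss → All (_≤ X) ss → #atMost X ss ≡ length ss
#atMost≡length X []       []             = refl
#atMost≡length X (s ∷ ss) (s≤X ∷ ss≤X) rewrite <⇒<ᵇ≡true (s≤s s≤X) = cong suc (#atMost≡length X ss ss≤X)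

#atMost-valleyBounds-≤ : ∀ X q a os → All (_≤ X) (a ∷ os) →
  #atMost X (valleyBounds q (a ∷ os)) ≡ suc (length (a ∷ os))
#atMost-valleyBounds-≤ X q a os (a≤X ∷ os≤X) =
  trans (#atMost≡length X _ (≤-trans (m⊓n≤n q a) a≤X ∷ valleyBounds-≤ X a os a≤X os≤X))
        (cong suc (length-valleyBounds a os))

-- Every valley bound next to a small pinnacle is at most X.
#atMost-valleyBounds-interleave : ∀ X q ss bs → X < q → All (_≤ X) ss → All (X <_) bs →
  (2 * length ss) ⊓ (length ss + length bs + 1) ≤ #atMost X (valleyBounds q (interleave ss bs))
#atMost-valleyBounds-interleave X q []       bs       _   _              _ = z≤n
#atMost-valleyBounds-interleave X q (s ∷ ss) []       _   ss≤X _ = ≤-trans (m⊓n≤n _ _)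
  (≤-reflexive (trans (e (length ss)) (sym (#atMost-valleyBounds-≤ X q s ss ss≤X))))
  where
  e : ∀ l → suc l + 0 + 1 ≡ suc (suc l)
  e = solve-∀
#atMost-valleyBounds-interleave X q (s ∷ ss) (b ∷ bs) X<q (s≤X ∷ ss≤X) (X<b ∷ X<bs)
  rewrite <⇒<ᵇ≡true (s≤s (≤-trans (m⊓n≤n q s) s≤X)) | <⇒<ᵇ≡true (s≤s (≤-trans (m⊓n≤m s b) s≤X)) =
  subst (_≤ 2 + #atMost X (valleyBounds b (interleave ss bs)))
    (sym (cong₂ _⊓_ (e₁ (length ss)) (e₂ (length ss) (length bs))))
    (s≤s (s≤s (#atMost-valleyBounds-interleave X b ss bs X<b ss≤X X<bs)))
  where
  e₁ : ∀ l → 2 * suc l ≡ suc (suc (2 * l))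
  e₁ = solve-∀
  e₂ : ∀ l l′ → suc l + suc l′ + 1 ≡ suc (suc (l + l′ + 1))
  e₂ = solve-∀

pinnacle⇒2≤#atMost-valleyBounds : ∀ X q {z} os → z ∈ os → z ≤ X → 2 ≤ #atMost X (valleyBounds q os)
pinnacle⇒2≤#atMost-valleyBounds X q (z ∷ os) (here refl) z≤X
  rewrite <⇒<ᵇ≡true (s≤s (≤-trans (m⊓n≤n q z) z≤X)) = s≤s (next os)
  where
  next : ∀ os → 1 ≤ #atMost X (valleyBounds z os)
  next []      rewrite <⇒<ᵇ≡true (s≤s z≤X) = s≤s z≤n
  next (c ∷ _) rewrite <⇒<ᵇ≡true (s≤s (≤-trans (m⊓n≤m z c) z≤X)) = s≤s z≤n
pinnacle⇒2≤#atMost-valleyBounds X q (o ∷ os) (there z∈os) z≤X =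
  ≤-trans (pinnacle⇒2≤#atMost-valleyBounds X o os z∈os z≤X) (m≤n+m _ _)

positive≤pred⇒< : ∀ {k X} → 1 ≤ k → k ≤ pred X → k < X
positive≤pred⇒< {X = zero}  (s≤s _) ()
positive≤pred⇒< {X = suc X} _       k≤X = s≤s k≤X

every-ordering⇒lowerBounds : ∀ p (x : Vec ℕ p) → StrictlyIncreasing x →
  (∀ os → os ↭ toList x → AdmissibleOrdering (toList x) os) → ∀ k → lowerBound p (suc (toℕ k)) ≤ lookup x k
every-ordering⇒lowerBounds p x increasing every k = bound (every os os↭S)
  where
  i = suc (toℕ k)
  X = lookup x k
  S = toList x
  small = take i S
  large = drop i S
  os = interleave small large
  os↭S : os ↭ S
  os↭S = ↭-trans (interleave↭++ small large) (↭-reflexive (take++drop≡id i S))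
  #below≡ : #below X os ≡ toℕ k
  #below≡ = trans (countᵇ-↭ (_<ᵇ X) os↭S) (#below-lookup x increasing k)
  #atMost≥ : (2 * i) ⊓ suc p ≤ #atMost X (valleyBounds (suc X) os)
  #atMost≥ = subst₂ (λ l l′ → (2 * l) ⊓ l′ ≤ #atMost X (valleyBounds (suc X) os))
    (length-take-toList x k)
    (trans (cong (_+ 1) (trans (sym (length-++ small)) (trans (cong length (take++drop≡id i S)) (length-toList x))))
           (+-comm p 1))
    (#atMost-valleyBounds-interleave X (suc X) small large ≤-refl
      (take-≤-lookup x increasing k) (drop->-lookup x increasing k))
  bound : AdmissibleOrdering S os → lowerBound p i ≤ X
  bound (N , w , w↭[N] , _ , pinnacles≡os) = subst (_≤ X) (sym (+-suc _ (toℕ k)))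
    (subst (λ l → suc l ≤ X) (+-comm (toℕ k) _)
      (positive≤pred⇒< (≤-trans (⊓-glb (s≤s z≤n) (s≤s z≤n)) (m≤n+m _ (toℕ k)))
        (≤-trans (+-mono-≤ (≤-reflexive (sym #below≡)) #atMost≥)
                 (subst (λ os → #below X os + #atMost X (valleyBounds (suc X) os) ≤ pred X) pinnacles≡os
                   (permutation-valley-count X {N} w↭[N])))))

module _ (p : ℕ) (x : Vec ℕ p) (increasing : StrictlyIncreasing x) where

  private
    valley-count-at : AdmissiblePinnacleSet (toList x) → ∀ k → Σ (List ℕ) λ os → os ↭ toList x ×
      toℕ k + #atMost (lookup x k) (valleyBounds (suc (lookup x k)) os) ≤ pred (lookup x k)
    valley-count-at (N , w , w↭[N] , pinnacles↭S) k = pinnacles w , pinnacles↭S , subst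
      (λ l → l + #atMost (lookup x k) (valleyBounds (suc (lookup x k)) (pinnacles w)) ≤ pred (lookup x k))
      (trans (countᵇ-↭ (_<ᵇ lookup x k) pinnacles↭S) (#below-lookup x increasing k))
      (permutation-valley-count (lookup x k) {N} w↭[N])

  admissible⇒lookup≥ : AdmissiblePinnacleSet (toList x) → ∀ k → toℕ k + 3 ≤ lookup x k
  admissible⇒lookup≥ admissible k with valley-count-at admissible k
  ... | os , os↭S , count = subst (_≤ lookup x k) (sym (+-suc (toℕ k) 2))
    (positive≤pred⇒< (≤-trans (s≤s z≤n) (m≤n+m 2 (toℕ k)))
    (≤-trans (+-monoʳ-≤ (toℕ k) (pinnacle⇒2≤#atMost-valleyBounds (lookup x k) (suc (lookup x k)) os
      (↭.∈-resp-↭ (↭-sym os↭S) (lookup∈toList x k)) ≤-refl)) count))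

  admissible⇒last≥ : AdmissiblePinnacleSet (toList x) → ∀ k → suc (toℕ k) ≡ p → 2 * p + 1 ≤ lookup x k
  admissible⇒last≥ admissible k last with valley-count-at admissible k
  ... | os , os↭S , count = subst (_≤ lookup x k) (e (toℕ k) p last)
    (positive≤pred⇒< (≤-trans (s≤s z≤n) (m≤n+m (suc p) (toℕ k)))
    (≤-trans (≤-reflexive (cong (toℕ k +_) (sym (all-counted os (↭.All-resp-↭ (↭-sym os↭S) S≤X)
      (trans (↭.↭-length os↭S) (length-toList x)))))) count))
    where
    X = lookup x k
    S≤X : All (_≤ X) (toList x)
    S≤X = All-toList x (λ j → StrictlyIncreasing-mono x increasing j k
      (≤-pred (subst (toℕ j <_) (sym last) (toℕ<n j))))
    all-counted : ∀ os → All (_≤ X) os → length os ≡ p → #atMost X (valleyBounds (suc X) os) ≡ suc p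
    all-counted []       _    length≡p = contradiction (trans length≡p (sym last)) λ ()
    all-counted (a ∷ os) os≤X length≡p = trans (#atMost-valleyBounds-≤ X (suc X) a os os≤X) (cong suc length≡p)
    e : ∀ k p → suc k ≡ p → suc (k + suc p) ≡ 2 * p + 1
    e k _ refl = identity k
      where
      identity : ∀ k → suc (k + suc (suc k)) ≡ 2 * suc k + 1
      identity = solve-∀

  condition⇒lowerBounds : AdmissiblePinnacleSet (toList x) → PinnacleOrderCondition x →
    ∀ k → lowerBound p (suc (toℕ k)) ≤ lookup x k
  condition⇒lowerBounds admissible _ fzero =
    ≤-trans (+-monoˡ-≤ 1 (m⊓n≤m 2 (suc p))) (admissible⇒lookup≥ admissible fzero)
  condition⇒lowerBounds admissible condition k@(fsuc _) with suc (toℕ k) ≟ p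
  ... | yes last = ≤-trans (+-monoˡ-≤ (suc (toℕ k)) (m⊓n≤n (2 * suc (toℕ k)) (suc p)))
    (≤-trans (≤-reflexive (trans (cong (suc p +_) last) (identity p))) (admissible⇒last≥ admissible k last))
    where
    identity : ∀ p → suc p + p ≡ 2 * p + 1
    identity = solve-∀
  ... | no ¬last = subst (_≤ lookup x k) (sym (lowerBound≡ p (suc (toℕ k))))
    (condition k (s≤s (s≤s z≤n)) (≤∧≢⇒< (toℕ<n k) ¬last))

corollary4p6 : (p : ℕ) (x : Vec ℕ p) → StrictlyIncreasing x →
    AdmissiblePinnacleSet (toList x) →
    ((∀ (o : List ℕ) → o ↭ toList x → AdmissibleOrdering (toList x) o) ⇔ PinnacleOrderCondition x)
corollary4p6 p x increasing admissible = mk⇔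
  (λ every k _ _ → subst (_≤ lookup x k) (lowerBound≡ p _) (every-ordering⇒lowerBounds p x increasing every k))
  (λ condition os os↭S → admissible-ordering os os↭S (realise-ordering p (toList x) os
    (StrictlyIncreasing⇒sorted x increasing)
    (lookup-bounds⇒MeetsLowerBoundsFrom p 0 x (condition⇒lowerBounds p x increasing admissible condition))
    os↭S (length-toList x)))
  where
  admissible-ordering : ∀ os → os ↭ toList x → (∃ λ N → Σ (List ℕ) λ w → IsPermOf N w × pinnacles w ≡ os) →
    AdmissibleOrdering (toList x) os
  admissible-ordering os os↭S (N , w , w↭[N] , pinnacles≡os) =
    N , w , w↭[N] , subst (_↭ toList x) (sym pinnacles≡os) os↭S , pinnacles≡os
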